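{- Let $G$ be a reduced graph and $M$ a simplicial module of $G$. If an AW $W$ in $G$ contains a vertex $x\in M$ and $V(W)\not\subseteq M$, then $x$ is a terminal of $W$. Moreover, if $G$ is connected, then $G-M$ is connected.
   Context: Graphs are finite, simple, undirected. A hole is an induced cycle of length at least 4. A long claw has vertices $c,v_1,v_2,v_3,t_1,t_2,t_3$ and exactly edges $cv_i,v_it_i$; a whipping top has vertices $t_1,t_2,t_3,v_2,v_3,c,u$ and exactly edges $t_2v_2,v_2c,cv_3,v_3t_3,ut_1,ut_2,uv_2,uc,uv_3,ut_3$; in both, the terminals are $t_1,t_2,t_3$. A $\dagger$-AW ($d\ge2$) has vertices $s,c,b_0,\dots,b_{d+1}$ and exactly edges $b_ib_{i+1}$ ($0\le i\le d$), $cs$, $cb_i$ ($1\le i\le d$). A $\ddagger$-AW ($d\ge1$) has vertices $s,c_1,c_2,b_0,\dots,b_{d+1}$ and exactly edges $b_ib_{i+1}$, $c_1c_2,c_1s,c_2s$, $c_jb_i$ ($j=1,2$, $1\le i\le d$), $c_1b_0$, $c_2b_{d+1}$; in both the terminals are $s,b_0,b_{d+1}$. An AW in $G$ is an induced subgraph isomorphic to one of these graphs; it is small if it is a long claw, whipping top, $\dagger$-AW with $d\le3$ or $\ddagger$-AW with $d\le3$. $G$ is reduced if it contains no hole and no small AW as an induced subgraph. A set $M$ is a module if every vertex outside $M$ is adjacent to all or none of $M$; a simplicial module is a module $M$ with $G[M]$ connected and $N(M)=\{v\notin M: v \text{ adjacent to some vertex of } M\}$ inducing a clique. -}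

module Defs where

open import Data.Nat using (ℕ; zero; suc; _≤_; _≡ᵇ_; _≤ᵇ_)
open import Data.Fin using (Fin; toℕ)
open import Data.Fin.Subset using (Subset; _∈_; _∉_; ⊤; ∁)
open import Data.Bool using (Bool; true; false; _∨_; _∧_)
open import Data.Product using (Σ; _×_; ∃; ∃-syntax)
open import Data.Sum using (_⊎_)
open import Data.Unit using () renaming (⊤ to Unit)
open import Relation.Nullary using (¬_)
open import Relation.Binary.PropositionalEquality using (_≡_; _≢_)

record Graph : Set where
  field
    n          : ℕ
    adj        : Fin n → Fin n → Bool
    adj-sym    : ∀ u v → adj u v ≡ adj v u
    adj-irrefl : ∀ v → adj v v ≡ false
open Graph public

record InducedCopy (G : Graph) (V : Set) (adjH : V → V → Bool) : Set where
  field
    emb     : V → Fin (n G)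
    emb-inj : ∀ u v → emb u ≡ emb v → u ≡ v
    emb-adj : ∀ u v → adj G (emb u) (emb v) ≡ adjH u v
open InducedCopy public

-- Holes: induced cycles of length k ≥ 4 (vertices 0,…,k-1 in cyclic order)

cycleAdj : (k : ℕ) → Fin k → Fin k → Bool
cycleAdj k i j =
  (toℕ j ≡ᵇ suc (toℕ i)) ∨ (toℕ i ≡ᵇ suc (toℕ j))
  ∨ ((toℕ i ≡ᵇ 0) ∧ (suc (toℕ j) ≡ᵇ k))
  ∨ ((toℕ j ≡ᵇ 0) ∧ (suc (toℕ i) ≡ᵇ k))

Hole : Graph → Set
Hole G = Σ ℕ λ k → (4 ≤ k) × InducedCopy G (Fin k) (cycleAdj k)

-- Asteroidal witnesses (AWs)

data AWType : Set where
  longClaw    : AWType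
  whippingTop : AWType
  dagger      : (d : ℕ) → AWType
  ddagger     : (d : ℕ) → AWType

ValidAW : AWType → Set
ValidAW longClaw    = Unit
ValidAW whippingTop = Unit
ValidAW (dagger d)  = 2 ≤ d
ValidAW (ddagger d) = 1 ≤ d

SmallAW : AWType → Set
SmallAW longClaw    = Unit
SmallAW whippingTop = Unit
SmallAW (dagger d)  = d ≤ 3
SmallAW (ddagger d) = d ≤ 3

data LCV : Set where
  c v₁ v₂ v₃ t₁ t₂ t₃ : LCV

lcAdj : LCV → LCV → Bool
lcAdj c  v₁ = true
lcAdj v₁ c  = true
lcAdj c  v₂ = true
lcAdj v₂ c  = true
lcAdj c  v₃ = true
lcAdj v₃ c  = true
lcAdj v₁ t₁ = true
lcAdj t₁ v₁ = true
lcAdj v₂ t₂ = true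
lcAdj t₂ v₂ = true
lcAdj v₃ t₃ = true
lcAdj t₃ v₃ = true
lcAdj _  _  = false

lcTerm : LCV → Bool
lcTerm t₁ = true
lcTerm t₂ = true
lcTerm t₃ = true
lcTerm _  = false

data WTV : Set where
  t₁ t₂ t₃ v₂ v₃ c u : WTV

wtAdj : WTV → WTV → Bool
wtAdj t₂ v₂ = true
wtAdj v₂ t₂ = true
wtAdj v₂ c  = true
wtAdj c  v₂ = true
wtAdj c  v₃ = true
wtAdj v₃ c  = true
wtAdj v₃ t₃ = true
wtAdj t₃ v₃ = true
wtAdj u  t₁ = true
wtAdj t₁ u  = true
wtAdj u  t₂ = true
wtAdj t₂ u  = true
wtAdj u  v₂ = true
wtAdj v₂ u  = true
wtAdj u  c  = true
wtAdj c  u  = true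
wtAdj u  v₃ = true
wtAdj v₃ u  = true
wtAdj u  t₃ = true
wtAdj t₃ u  = true
wtAdj _  _  = false

wtTerm : WTV → Bool
wtTerm t₁ = true
wtTerm t₂ = true
wtTerm t₃ = true
wtTerm _  = false

-- helpers on the path b₀ … b_{d+1}  (indices Fin (suc (suc d)))
consec : ∀ {m} → Fin m → Fin m → Bool
consec i j = (toℕ j ≡ᵇ suc (toℕ i)) ∨ (toℕ i ≡ᵇ suc (toℕ j))

inner : (d : ℕ) → Fin (suc (suc d)) → Bool
inner d i = (1 ≤ᵇ toℕ i) ∧ (toℕ i ≤ᵇ d)

endpoint : (d : ℕ) → Fin (suc (suc d)) → Bool
endpoint d i = (toℕ i ≡ᵇ 0) ∨ (toℕ i ≡ᵇ suc d)

data DagV (d : ℕ) : Set where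
  s c : DagV d
  b   : Fin (suc (suc d)) → DagV d

dagAdj : (d : ℕ) → DagV d → DagV d → Bool
dagAdj d c     s     = true
dagAdj d s     c     = true
dagAdj d c     (b i) = inner d i
dagAdj d (b i) c     = inner d i
dagAdj d (b i) (b j) = consec i j
dagAdj d _     _     = false

dagTerm : (d : ℕ) → DagV d → Bool
dagTerm d s     = true
dagTerm d (b i) = endpoint d i
dagTerm d _     = false

data DdagV (d : ℕ) : Set where
  s c₁ c₂ : DdagV d
  b       : Fin (suc (suc d)) → DdagV d

ddagAdj : (d : ℕ) → DdagV d → DdagV d → Bool
ddagAdj d c₁    c₂    = true
ddagAdj d c₂    c₁    = true
ddagAdj d c₁    s     = true
ddagAdj d s     c₁    = true
ddagAdj d c₂    s     = true
ddagAdj d s     c₂    = true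
ddagAdj d c₁    (b i) = inner d i ∨ (toℕ i ≡ᵇ 0)
ddagAdj d (b i) c₁    = inner d i ∨ (toℕ i ≡ᵇ 0)
ddagAdj d c₂    (b i) = inner d i ∨ (toℕ i ≡ᵇ suc d)
ddagAdj d (b i) c₂    = inner d i ∨ (toℕ i ≡ᵇ suc d)
ddagAdj d (b i) (b j) = consec i j
ddagAdj d _     _     = false

ddagTerm : (d : ℕ) → DdagV d → Bool
ddagTerm d s     = true
ddagTerm d (b i) = endpoint d i
ddagTerm d _     = false

AWVertex : AWType → Set
AWVertex longClaw    = LCV
AWVertex whippingTop = WTV
AWVertex (dagger d)  = DagV d
AWVertex (ddagger d) = DdagV d

awAdj : (t : AWType) → AWVertex t → AWVertex t → Bool
awAdj longClaw    = lcAdj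
awAdj whippingTop = wtAdj
awAdj (dagger d)  = dagAdj d
awAdj (ddagger d) = ddagAdj d

awTerminal : (t : AWType) → AWVertex t → Bool
awTerminal longClaw    = lcTerm
awTerminal whippingTop = wtTerm
awTerminal (dagger d)  = dagTerm d
awTerminal (ddagger d) = ddagTerm d

-- An AW in G: an induced subgraph isomorphic to one of the AW graphs,
-- recorded together with the isomorphism (which fixes its terminals).
record AW (G : Graph) : Set where
  field
    type  : AWType
    valid : ValidAW type
    copy  : InducedCopy G (AWVertex type) (awAdj type)
open AW public

awVert : {G : Graph} (W : AW G) → AWVertex (type W) → Fin (n G)
awVert W w = emb (copy W) w

IsTerminalOf : {G : Graph} → Fin (n G) → AW G → Set
IsTerminalOf x W = ∃[ w ] (awTerminal (type W) w ≡ true × awVert W w ≡ x)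

Reduced : Graph → Set
Reduced G = ¬ Hole G × ¬ (Σ (AW G) λ W → SmallAW (type W))

IsModule : (G : Graph) → Subset (n G) → Set
IsModule G M = ∀ v → v ∉ M →
  (∀ u → u ∈ M → adj G v u ≡ true) ⊎ (∀ u → u ∈ M → adj G v u ≡ false)

data PathIn (G : Graph) (S : Subset (n G)) : Fin (n G) → Fin (n G) → Set where
  here : ∀ {u} → u ∈ S → PathIn G S u u
  step : ∀ {u w v} → u ∈ S → adj G u w ≡ true → PathIn G S w v → PathIn G S u v

ConnectedOn : (G : Graph) → Subset (n G) → Set
ConnectedOn G S = ∀ u v → u ∈ S → v ∈ S → PathIn G S u v

Connected : Graph → Set
Connected G = ConnectedOn G ⊤

InNbhd : (G : Graph) → Subset (n G) → Fin (n G) → Set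
InNbhd G M v = v ∉ M × ∃[ m ] (m ∈ M × adj G v m ≡ true)

IsSimplicialModule : (G : Graph) → Subset (n G) → Set
IsSimplicialModule G M =
  IsModule G M × ConnectedOn G M ×
  (∀ u v → InNbhd G M u → InNbhd G M v → u ≢ v → adj G u v ≡ true)

module Submission where

-- Part 1.  Pull M back along the embedding of W to a set S of vertices of the
-- model graph H.  Because M is a module, a vertex of H adjacent to one member of
-- S and non-adjacent to another is itself a member; because N(M) is a clique, two
-- non-adjacent neighbours of a member are not both non-members.  A set with these
-- two properties is called closed.  In a closed set, non-adjacent neighbours of a
-- member are both members, so membership spreads along an induced path from any
-- inner vertex to the whole path, and from the path to the hub vertices.  Hence a
-- closed set of a †-AW or ‡-AW (any d ≥ 1) that contains a non-terminal contains
-- every vertex.  A reduced graph has no long claw and no whipping top, so this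
-- covers every AW of G, and part 1 follows by taking S = W ∩ M.
--
-- Part 2.  A walk of G ending outside M is rerouted into G − M: an excursion into
-- M is entered and left through N(M), which is a clique, so it can be replaced by
-- a single edge.

open import Defs
open import Data.Fin.Subset using (Subset; _∈_; _∉_; ∁)
open import Data.Fin using (Fin)
open import Relation.Binary.PropositionalEquality using (_≡_)
open import Data.Product using (_×_; ∃-syntax)

open import Data.Bool using (Bool; true; false; T; _∨_)
open import Data.Bool.Properties using (∨-identityʳ)
open import Data.Empty using (⊥-elim)
open import Data.Fin using (zero; suc; toℕ; fromℕ; fromℕ<)
open import Data.Fin.Properties using (toℕ-injective; toℕ-fromℕ<; toℕ<n) renaming (_≟_ to _≟ᶠ_)
open import Data.Fin.Subset using (⊤)
open import Data.Fin.Subset.Properties using (_∈?_; x∈∁p⇒x∉p; x∉p⇒x∈∁p; ∈⊤)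
open import Data.Nat using (ℕ; zero; suc; _+_; _∸_; _≤_; _<_; z≤n; s≤s; s≤s⁻¹; _≡ᵇ_)
open import Data.Nat.Properties using (≡⇒≡ᵇ; ≤-trans; ≤-total; n≤1+n; n<1+n; m≤n⇒m≤1+n; <⇒≢; ≤∧≢⇒<; m∸n+n≡m)
open import Data.Product using (_,_; proj₁; proj₂)
open import Data.Sum using (_⊎_; inj₁; inj₂)
open import Data.Unit using (tt)
open import Relation.Nullary using (yes; no)
open import Relation.Binary.PropositionalEquality using (_≢_; refl; sym; trans; cong; subst)

NbhdIsClique : (G : Graph) → Subset (n G) → Set
NbhdIsClique G M = ∀ u v → InNbhd G M u → InNbhd G M v → u ≢ v → adj G u v ≡ true

record Closed {V : Set} (adjH : V → V → Bool) (S : V → Set) : Set where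
  field
    separating : ∀ {x y z} → adjH x y ≡ true → adjH x z ≡ false → S y → S z → S x
    nbhdClique : ∀ {y p q} → p ≢ q → adjH p y ≡ true → adjH q y ≡ true →
                 adjH p q ≡ false → S y → S p ⊎ S q
open Closed

true≢false : true ≢ false
true≢false ()

trace-closed : (G : Graph) (M : Subset (n G)) → IsModule G M → NbhdIsClique G M →
  ∀ {V adjH} (cp : InducedCopy G V adjH) → Closed adjH (λ v → emb cp v ∈ M)
trace-closed G M isModule clique {V} {adjH} cp = record { separating = separates ; nbhdClique = nbhd }
  where
  separates : ∀ {x y z} → adjH x y ≡ true → adjH x z ≡ false →
              emb cp y ∈ M → emb cp z ∈ M → emb cp x ∈ M
  separates {x} {y} {z} x∼y x≁z y∈M z∈M with emb cp x ∈? M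
  ... | yes x∈M = x∈M
  ... | no x∉M with isModule (emb cp x) x∉M
  ...   | inj₁ sees-all  = ⊥-elim (true≢false (trans (sym (sees-all _ z∈M)) (trans (emb-adj cp x z) x≁z)))
  ...   | inj₂ sees-none = ⊥-elim (true≢false (sym (trans (sym (sees-none _ y∈M)) (trans (emb-adj cp x y) x∼y))))

  nbhd : ∀ {y p q} → p ≢ q → adjH p y ≡ true → adjH q y ≡ true → adjH p q ≡ false →
         emb cp y ∈ M → emb cp p ∈ M ⊎ emb cp q ∈ M
  nbhd {y} {p} {q} p≢q p∼y q∼y p≁q y∈M with emb cp p ∈? M | emb cp q ∈? M
  ... | yes p∈M | _       = inj₁ p∈M
  ... | no _    | yes q∈M = inj₂ q∈M
  ... | no p∉M  | no q∉M  = ⊥-elim (true≢false (trans (sym p∼q) (trans (emb-adj cp p q) p≁q)))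
    where
    p∼q : adj G (emb cp p) (emb cp q) ≡ true
    p∼q = clique _ _ (p∉M , emb cp y , y∈M , trans (emb-adj cp p y) p∼y)
                     (q∉M , emb cp y , y∈M , trans (emb-adj cp q y) q∼y)
                     (λ e → p≢q (emb-inj cp p q e))

-- Two distinct, mutually non-adjacent neighbours of a member of a closed set are
-- both members: one of them is, and then it separates the other from y.
nonadjacent-neighbours : ∀ {V adjH S} → Closed {V} adjH S → ∀ {y p q} → p ≢ q →
  adjH p y ≡ true → adjH q y ≡ true → adjH p q ≡ false → adjH q p ≡ false →
  S y → S p × S q
nonadjacent-neighbours closed p≢q py qy p≁q q≁p y∈S
  with nbhdClique closed p≢q py qy p≁q y∈S
... | inj₁ p∈S = p∈S , separating closed qy q≁p y∈S p∈S
... | inj₂ q∈S = separating closed py p≁q y∈S q∈S , q∈S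

module IntervalSpread (P : ℕ → Set) (D : ℕ)
  (spread : ∀ m → suc m ≤ D → P (suc m) → P m × P (suc (suc m))) where

  downward : ∀ t k → t + k ≤ D → P (t + k) → P k
  downward zero    k _ p = p
  downward (suc t) k h p = downward t k (≤-trans (n≤1+n _) h) (proj₁ (spread (t + k) h p))

  upward : ∀ t m → suc (t + m) ≤ suc D → P (suc m) → P (suc (t + m))
  upward zero    m _ p = p
  upward (suc t) m h p = proj₂ (spread (t + m) (s≤s⁻¹ h) (upward t m (≤-trans (n≤1+n _) h) p))

  everywhere : ∀ {i} → suc i ≤ D → P (suc i) → ∀ k → k ≤ suc D → P k
  everywhere {i} i<D p k k≤ with ≤-total k (suc i)
  ... | inj₁ k≤i+1 = downward (suc i ∸ k) k (subst (_≤ D) (sym back) i<D) (subst P (sym back) p)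
    where back = m∸n+n≡m k≤i+1
  ... | inj₂ (s≤s {n = k′} i≤k′) =
    subst P (cong suc back) (upward (k′ ∸ i) i (subst (λ j → suc j ≤ suc D) (sym back) k≤) p)
    where back = m∸n+n≡m i≤k′

-- Adjacency of consecutive indices, computed on ℕ; consec i j unfolds to
-- consecutive (toℕ i) (toℕ j).
consecutive : ℕ → ℕ → Bool
consecutive m n = (n ≡ᵇ suc m) ∨ (m ≡ᵇ suc n)

consecutive-next : ∀ a → consecutive a (suc a) ≡ true
consecutive-next zero    = refl
consecutive-next (suc a) = consecutive-next a

consecutive-prev : ∀ a → consecutive (suc a) a ≡ true
consecutive-prev zero    = refl
consecutive-prev (suc a) = consecutive-prev a

consecutive-gap : ∀ a → consecutive a (suc (suc a)) ≡ false
consecutive-gap zero    = refl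
consecutive-gap (suc a) = consecutive-gap a

consecutive-gap′ : ∀ a → consecutive (suc (suc a)) a ≡ false
consecutive-gap′ zero    = refl
consecutive-gap′ (suc a) = consecutive-gap′ a

consec-at : ∀ {k} {i j : Fin k} {m n} → toℕ i ≡ m → toℕ j ≡ n → consec i j ≡ consecutive m n
consec-at refl refl = refl

module InducedPath {V : Set} {adjH : V → V → Bool} {S : V → Set} (closed : Closed adjH S)
  (d : ℕ) (b : Fin (suc (suc d)) → V)
  (b-path : ∀ i j → adjH (b i) (b j) ≡ consec i j)
  (b-inj : ∀ i j → b i ≡ b j → i ≡ j) where

  InAt : ℕ → Set
  InAt k = ∀ j → toℕ j ≡ k → S (b j)

  inAt : ∀ {j k} → toℕ j ≡ k → S (b j) → InAt k
  inAt e member j′ e′ = subst (λ i → S (b i)) (toℕ-injective (trans e (sym e′))) member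

  position : ∀ {k} → k < suc (suc d) → ∃[ j ] toℕ j ≡ k
  position k< = fromℕ< k< , toℕ-fromℕ< k<

  -- b_m and b_{m+2} are non-adjacent neighbours of the inner vertex b_{m+1}.
  spread : ∀ m → suc m ≤ d → InAt (suc m) → InAt m × InAt (suc (suc m))
  spread m m<d mid with position (m≤n⇒m≤1+n (m≤n⇒m≤1+n m<d))
                      | position (s≤s (m≤n⇒m≤1+n m<d)) | position (s≤s (s≤s m<d))
  ... | (j₀ , e₀) | (j₁ , e₁) | (j₂ , e₂) = inAt e₀ (proj₁ both) , inAt e₂ (proj₂ both)
    where
    distinct : b j₀ ≢ b j₂
    distinct eq = <⇒≢ (m≤n⇒m≤1+n (n<1+n m)) (trans (sym e₀) (trans (cong toℕ (b-inj _ _ eq)) e₂))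
    both : S (b j₀) × S (b j₂)
    both = nonadjacent-neighbours closed distinct
      (trans (b-path j₀ j₁) (trans (consec-at e₀ e₁) (consecutive-next m)))
      (trans (b-path j₂ j₁) (trans (consec-at e₂ e₁) (consecutive-prev (suc m))))
      (trans (b-path j₀ j₂) (trans (consec-at e₀ e₂) (consecutive-gap m)))
      (trans (b-path j₂ j₀) (trans (consec-at e₂ e₀) (consecutive-gap′ m)))
      (mid j₁ e₁)

  open IntervalSpread InAt d spread using (everywhere)

  absorbed : ∀ i → suc (toℕ i) ≤ d → S (b (suc i)) → ∀ j → S (b j)
  absorbed i i<d member j = everywhere i<d (inAt refl member) (toℕ j) (s≤s⁻¹ (toℕ<n j)) j refl

inner-index : ∀ {d} (i : Fin (suc d)) → (toℕ i ≡ᵇ d) ≡ false → suc (toℕ i) ≤ d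
inner-index {d} i not-last = ≤∧≢⇒< (s≤s⁻¹ (toℕ<n i)) (λ e → subst T not-last (≡⇒≡ᵇ _ _ e))

last-not-inner : ∀ d → inner d (fromℕ (suc d)) ≡ false
last-not-inner zero    = refl
last-not-inner (suc d) = last-not-inner d

dagger-absorbed : ∀ d {S : DagV (suc d) → Set} → Closed (dagAdj (suc d)) S →
  ∀ w → dagTerm (suc d) w ≡ false → S w → ∀ w′ → S w′
dagger-absorbed d {S} closed = from-nonterminal
  where
  b-inj : ∀ i j → DagV.b i ≡ DagV.b j → i ≡ j
  b-inj _ _ refl = refl
  open InducedPath closed (suc d) DagV.b (λ _ _ → refl) b-inj

  -- c separates b₁ from b₀, and s separates c from b₀.
  from-path : (∀ j → S (DagV.b j)) → ∀ w → S w
  from-path on-path DagV.s     = separating closed refl refl (from-path on-path DagV.c) (on-path zero)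
  from-path on-path DagV.c     = separating closed refl refl (on-path (suc zero)) (on-path zero)
  from-path on-path (DagV.b j) = on-path j

  from-nonterminal : ∀ w → dagTerm (suc d) w ≡ false → S w → ∀ w′ → S w′
  from-nonterminal DagV.s () _
  from-nonterminal DagV.c _ c∈S = from-path (absorbed zero (s≤s z≤n) b₁∈S)
    where b₁∈S = proj₂ (nonadjacent-neighbours closed {p = DagV.s} {q = DagV.b (suc zero)} (λ ()) refl refl refl refl c∈S)
  from-nonterminal (DagV.b zero) () _
  from-nonterminal (DagV.b (suc i)) not-end b∈S = from-path (absorbed i (inner-index i not-end) b∈S)

ddagger-absorbed : ∀ d {S : DdagV (suc d) → Set} → Closed (ddagAdj (suc d)) S →
  ∀ w → ddagTerm (suc d) w ≡ false → S w → ∀ w′ → S w′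
ddagger-absorbed d {S} closed = from-nonterminal
  where
  b-inj : ∀ i j → DdagV.b i ≡ DdagV.b j → i ≡ j
  b-inj _ _ refl = refl
  open InducedPath closed (suc d) DdagV.b (λ _ _ → refl) b-inj

  c₁≁last : ddagAdj (suc d) DdagV.c₁ (DdagV.b (fromℕ (suc (suc d)))) ≡ false
  c₁≁last = trans (∨-identityʳ _) (last-not-inner (suc d))

  -- c₁ separates b₀ from b_{d+1}, c₂ separates b₁ from b₀, s separates c₁ from b₀.
  from-path : (∀ j → S (DdagV.b j)) → ∀ w → S w
  from-path on-path DdagV.s      = separating closed refl refl (from-path on-path DdagV.c₁) (on-path zero)
  from-path on-path DdagV.c₁     = separating closed refl c₁≁last (on-path zero) (on-path (fromℕ (suc (suc d))))
  from-path on-path DdagV.c₂     = separating closed refl refl (on-path (suc zero)) (on-path zero)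
  from-path on-path (DdagV.b j)  = on-path j

  -- s and b₁ are non-adjacent neighbours of both c₁ and c₂.
  from-hub : ∀ {h} → ddagAdj (suc d) DdagV.s h ≡ true → ddagAdj (suc d) (DdagV.b (suc zero)) h ≡ true →
    S h → ∀ w′ → S w′
  from-hub s∼h b₁∼h h∈S = from-path (absorbed zero (s≤s z≤n) b₁∈S)
    where b₁∈S = proj₂ (nonadjacent-neighbours closed {p = DdagV.s} {q = DdagV.b (suc zero)} (λ ()) s∼h b₁∼h refl refl h∈S)

  from-nonterminal : ∀ w → ddagTerm (suc d) w ≡ false → S w → ∀ w′ → S w′
  from-nonterminal DdagV.s () _
  from-nonterminal DdagV.c₁ _ = from-hub refl refl
  from-nonterminal DdagV.c₂ _ = from-hub refl refl
  from-nonterminal (DdagV.b zero) () _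
  from-nonterminal (DdagV.b (suc i)) not-end b∈S = from-path (absorbed i (inner-index i not-end) b∈S)

-- In a reduced graph every AW is a †-AW or a ‡-AW, so a closed set of its model
-- graph containing a non-terminal contains every vertex.
aw-absorbed : ∀ {G} → Reduced G → (W : AW G) → ∀ {S} → Closed (awAdj (type W)) S →
  ∀ w → awTerminal (type W) w ≡ false → S w → ∀ w′ → S w′
aw-absorbed (_ , noSmall) W@record { type = longClaw }    _ = ⊥-elim (noSmall (W , tt))
aw-absorbed (_ , noSmall) W@record { type = whippingTop } _ = ⊥-elim (noSmall (W , tt))
aw-absorbed _ record { type = dagger (suc d) }  = dagger-absorbed d
aw-absorbed _ record { type = ddagger (suc d) } = ddagger-absorbed d
aw-absorbed _ record { type = dagger zero ; valid = () }
aw-absorbed _ record { type = ddagger zero ; valid = () }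

module Reroute (G : Graph) (M : Subset (n G)) (clique : NbhdIsClique G M) where

  join-nbhd : ∀ {x z y} → InNbhd G M x → InNbhd G M z → PathIn G (∁ M) z y → PathIn G (∁ M) x y
  join-nbhd {x} {z} x∈N z∈N z⇝y with x ≟ᶠ z
  ... | yes refl = z⇝y
  ... | no x≢z   = step (x∉p⇒x∈∁p (proj₁ x∈N)) (clique x z x∈N z∈N x≢z) z⇝y

  reroute : ∀ {x y} → PathIn G ⊤ x y → y ∉ M →
    (x ∉ M → PathIn G (∁ M) x y) × (x ∈ M → ∃[ z ] (InNbhd G M z × PathIn G (∁ M) z y))
  reroute (here _) y∉M = (λ x∉M → here (x∉p⇒x∈∁p x∉M)) , (λ x∈M → ⊥-elim (y∉M x∈M))
  reroute {x} (step {w = x′} _ x∼x′ rest) y∉M = from-outside , from-inside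
    where
    from-outside : x ∉ M → PathIn G (∁ M) x _
    from-outside x∉M with x′ ∈? M
    ... | no x′∉M = step (x∉p⇒x∈∁p x∉M) x∼x′ (proj₁ (reroute rest y∉M) x′∉M)
    ... | yes x′∈M with proj₂ (reroute rest y∉M) x′∈M
    ...   | (z , z∈N , z⇝y) = join-nbhd (x∉M , x′ , x′∈M , x∼x′) z∈N z⇝y

    from-inside : x ∈ M → ∃[ z ] (InNbhd G M z × PathIn G (∁ M) z _)
    from-inside x∈M with x′ ∈? M
    ... | yes x′∈M = proj₂ (reroute rest y∉M) x′∈M
    ... | no x′∉M  = x′ , (x′∉M , x , x∈M , trans (adj-sym G x′ x) x∼x′) , proj₁ (reroute rest y∉M) x′∉M

lemma11 : (G : Graph) → Reduced G → (M : Subset (n G)) → IsSimplicialModule G M →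
    ((W : AW G) → (x : Fin (n G)) → x ∈ M → (∃[ w ] awVert W w ≡ x) → (∃[ w ] awVert W w ∉ M) → IsTerminalOf x W)
    × (Connected G → ConnectedOn G (∁ M))
lemma11 G reduced M (isModule , _ , clique) = terminals , connected
  where
  terminals : (W : AW G) → (x : Fin (n G)) → x ∈ M → (∃[ w ] awVert W w ≡ x) →
    (∃[ w ] awVert W w ∉ M) → IsTerminalOf x W
  terminals W x x∈M (w , w↦x) (w′ , w′∉M) with awTerminal (type W) w in term
  ... | true  = w , term , w↦x
  ... | false = ⊥-elim (w′∉M (aw-absorbed reduced W (trace-closed G M isModule clique (copy W))
                                 w term (subst (_∈ M) (sym w↦x) x∈M) w′))

  connected : Connected G → ConnectedOn G (∁ M)
  connected conn x y x∉M y∉M =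
    proj₁ (Reroute.reroute G M clique (conn x y ∈⊤ ∈⊤) (x∈∁p⇒x∉p y∉M)) (x∈∁p⇒x∉p x∉M)
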